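{- For every integer $n \geq 0$, the ladder $L_n = P_n \,\square\, K_2$ is $(5,1)$-total-threshold-colorable.
   Context: All graphs are finite, simple and undirected. $P_n$ is the path of length $n$ (with $n$ edges), $K_2$ the complete graph on two vertices, and $G \,\square\, H$ the Cartesian product (vertex set $V(G)\times V(H)$, with $(v,w),(x,y)$ adjacent iff either $v=x$ and $wy \in E(H)$, or $w=y$ and $vx \in E(G)$). A near-far-labeling of a graph $G$ is a pair $(N,F)$ with $N \subseteq E(G)$ and $F = E(G)\setminus N$. For integers $r \geq t$, an $(r,t)$-threshold-coloring of $G$ with respect to $(N,F)$ is a map $c: V(G) \to \{0,\ldots,r-1\}$ with $|c(u)-c(v)| \leq t$ for every $uv \in N$ and $|c(u)-c(v)| > t$ for every $uv \in F$. $G$ is $(r,t)$-total-threshold-colorable if it admits an $(r,t)$-threshold-coloring with respect to every near-far-labeling. -}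

module Defs where

open import Level using (0ℓ)
open import Data.Nat using (ℕ; zero; suc; _≤_; _>_; _+_)
open import Data.Nat.Properties using ()
open import Data.Fin using (Fin; toℕ)
open import Data.Bool using (Bool; true; false)
open import Data.Product using (_×_; _,_; Σ; ∃)
open import Data.Sum using (_⊎_)
open import Data.Empty using (⊥)
open import Relation.Nullary using (¬_)
open import Relation.Binary.PropositionalEquality using (_≡_)

record Graph : Set₁ where
  field
    order  : ℕ
    Adj    : Fin order → Fin order → Set
    irrefl : ∀ x → ¬ Adj x x
    sym    : ∀ {x y} → Adj x y → Adj y x
open Graph public

Vtx : Graph → Set
Vtx G = Fin (order G)

∣_-_∣ : ℕ → ℕ → ℕ
∣ zero  - n     ∣ = n
∣ suc m - zero  ∣ = suc m
∣ suc m - suc n ∣ = ∣ m - n ∣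

P : ℕ → Graph
P n = record
  { order  = suc n
  ; Adj    = λ i j → ∣ toℕ i - toℕ j ∣ ≡ 1
  ; irrefl = λ x e → irr (toℕ x) e
  ; sym    = λ {x} {y} e → symm (toℕ x) (toℕ y) e
  }
  where
  irr : ∀ m → ¬ (∣ m - m ∣ ≡ 1)
  irr zero ()
  irr (suc m) e = irr m e
  symm : ∀ a b → ∣ a - b ∣ ≡ 1 → ∣ b - a ∣ ≡ 1
  symm zero zero e = e
  symm zero (suc b) e = e
  symm (suc a) zero e = e
  symm (suc a) (suc b) e = symm a b e

K2 : Graph
K2 = record
  { order  = 2
  ; Adj    = λ i j → ¬ (i ≡ j)
  ; irrefl = λ x ne → ne Relation.Binary.PropositionalEquality.refl
  ; sym    = λ ne e → ne (Relation.Binary.PropositionalEquality.sym e)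
  }

record GraphOn (V : Set) : Set₁ where
  field
    E      : V → V → Set
    irrefl : ∀ x → ¬ E x x
    sym    : ∀ {x y} → E x y → E y x

asGraphOn : (G : Graph) → GraphOn (Vtx G)
asGraphOn G = record { E = Adj G ; irrefl = irrefl G ; sym = Graph.sym G }

_□_ : (G H : Graph) → GraphOn (Vtx G × Vtx H)
G □ H = record
  { E      = λ { (v , w) (x , y) → (v ≡ x × Adj H w y) ⊎ (w ≡ y × Adj G v x) }
  ; irrefl = λ { (v , w) (Data.Sum.inj₁ (_ , a)) → irrefl H w a
               ; (v , w) (Data.Sum.inj₂ (_ , a)) → irrefl G v a }
  ; sym    = λ { (Data.Sum.inj₁ (e , a)) → Data.Sum.inj₁ (Relation.Binary.PropositionalEquality.sym e , Graph.sym H a)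
               ; (Data.Sum.inj₂ (e , a)) → Data.Sum.inj₂ (Relation.Binary.PropositionalEquality.sym e , Graph.sym G a) }
  }

-- A near-far-labeling (N, F = E \ N): an edge uv is near iff near u v = true, far otherwise.
-- The label is given on vertex pairs (only its values on edges matter) and is symmetric,
-- since it labels undirected edges.
record NearFar {V : Set} (G : GraphOn V) : Set where
  field
    near     : V → V → Bool
    near-sym : ∀ {u v} → GraphOn.E G u v → near u v ≡ near v u
open NearFar public

IsThresholdColoring : {V : Set} (G : GraphOn V) (L : NearFar G) (r t : ℕ) → (V → Fin r) → Set
IsThresholdColoring G L r t c =
  ∀ {u v} (e : GraphOn.E G u v) →
    (near L u v ≡ true  → ∣ toℕ (c u) - toℕ (c v) ∣ ≤ t) ×
    (near L u v ≡ false → ∣ toℕ (c u) - toℕ (c v) ∣ > t)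

-- (The paper's standing convention r ≥ t is a side condition on the parameters, satisfied by (5,1).)
TotalThresholdColorable : {V : Set} (G : GraphOn V) (r t : ℕ) → Set
TotalThresholdColorable {V} G r t =
  ∀ (L : NearFar G) → Σ (V → Fin r) (IsThresholdColoring G L r t)

Ladder : (n : ℕ) → GraphOn (Vtx (P n) × Vtx K2)
Ladder n = P n □ K2

-- Colour the ladder column by column, a column being a pair of colours.  A
-- greedy left-to-right colouring that only sees the labels up to the new
-- column cannot work: no nonempty family of columns is closed under such
-- extensions.  Looking one rung further ahead suffices: there are families
-- S(r, r′) of columns, for rung label r and next rung label r′, whose columns
-- fit the rung r and can always be extended by a column of S(r′, r″),
-- whatever the two rail labels in between and the following rung label r″.
module Submission where

open import Defs
open import Data.Nat using (ℕ; zero; suc; _≤_; _<_; _≤?_; _<?_)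
open import Data.Fin using (Fin; toℕ; fromℕ<; #_) renaming (zero to fzero; suc to fsuc)
open import Data.Fin.Properties using (toℕ<n; fromℕ<-toℕ)
open import Data.Bool using (Bool; true; false)
open import Data.Product using (∃; _×_; _,_; proj₁; proj₂)
open import Data.Sum using (_⊎_; inj₁; inj₂)
open import Data.Empty using (⊥-elim)
open import Data.List using (List; []; _∷_)
open import Data.List.Relation.Unary.All as All using (All)
open import Data.List.Relation.Unary.Any as Any using (Any; here)
open import Data.List.Membership.Propositional using (_∈_; find)
open import Relation.Nullary using (Dec; yes; no)
open import Relation.Nullary.Decidable using (from-yes; _×-dec_)
open import Relation.Binary.PropositionalEquality using (_≡_; refl; cong; subst; subst₂)

∣-∣-comm : ∀ m n → ∣ m - n ∣ ≡ ∣ n - m ∣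
∣-∣-comm zero    zero    = refl
∣-∣-comm zero    (suc n) = refl
∣-∣-comm (suc m) zero    = refl
∣-∣-comm (suc m) (suc n) = ∣-∣-comm m n

∣m-n∣≡1⇒n≡1+m⊎m≡1+n : ∀ m n → ∣ m - n ∣ ≡ 1 → n ≡ suc m ⊎ m ≡ suc n
∣m-n∣≡1⇒n≡1+m⊎m≡1+n zero          (suc zero) _ = inj₁ refl
∣m-n∣≡1⇒n≡1+m⊎m≡1+n (suc zero)    zero       _ = inj₂ refl
∣m-n∣≡1⇒n≡1+m⊎m≡1+n (suc m)       (suc n)    d with ∣m-n∣≡1⇒n≡1+m⊎m≡1+n m n d
... | inj₁ n≡1+m = inj₁ (cong suc n≡1+m)
... | inj₂ m≡1+n = inj₂ (cong suc m≡1+n)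

∀-Bool? : {P : Bool → Set} → (∀ b → Dec (P b)) → Dec (∀ b → P b)
∀-Bool? P? with P? false | P? true
... | yes p | yes q = yes λ { false → p ; true → q }
... | no ¬p | _     = no λ ∀P → ¬p (∀P false)
... | _     | no ¬q = no λ ∀P → ¬q (∀P true)

Fits : ℕ → Bool → ℕ → Set
Fits t true  m = m ≤ t
Fits t false m = t < m

fits? : ∀ t l m → Dec (Fits t l m)
fits? t true  m = m ≤? t
fits? t false m = t <? m

distance : ∀ {r} → Fin r → Fin r → ℕ
distance a b = ∣ toℕ a - toℕ b ∣

module _ {V : Set} {G : GraphOn V} (L : NearFar G) {r : ℕ} (c : V → Fin r) (t : ℕ) where

  FitsEdge : V → V → Set
  FitsEdge u v = Fits t (near L u v) (distance (c u) (c v))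

  fitsEdge-sym : ∀ {u v} → GraphOn.E G u v → FitsEdge v u → FitsEdge u v
  fitsEdge-sym {u} {v} e fits rewrite near-sym L e | ∣-∣-comm (toℕ (c u)) (toℕ (c v)) = fits

  fitsEdge⇒thresholdColoring : (∀ {u v} → GraphOn.E G u v → FitsEdge u v) → IsThresholdColoring G L r t c
  fitsEdge⇒thresholdColoring fits {u} {v} e with near L u v | fits e
  ... | true  | m≤t = (λ _ → m≤t) , λ ()
  ... | false | t<m = (λ ()) , λ _ → t<m

Colour : Set
Colour = Fin 5

Column : Set
Column = Colour × Colour

-- The largest family with the extension property, found by fixed-point iteration.
safe : Bool → Bool → List Column
safe true  true  = (# 0 , # 0) ∷ (# 1 , # 1) ∷ (# 1 , # 2) ∷ (# 2 , # 1)
                 ∷ (# 2 , # 3) ∷ (# 3 , # 2) ∷ (# 3 , # 3) ∷ (# 4 , # 4) ∷ []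
safe true  false = (# 0 , # 1) ∷ (# 1 , # 0) ∷ (# 1 , # 2) ∷ (# 2 , # 1)
                 ∷ (# 2 , # 3) ∷ (# 3 , # 2) ∷ (# 3 , # 4) ∷ (# 4 , # 3) ∷ []
safe false true  = (# 0 , # 2) ∷ (# 0 , # 3) ∷ (# 1 , # 4) ∷ (# 2 , # 0)
                 ∷ (# 2 , # 4) ∷ (# 3 , # 0) ∷ (# 4 , # 1) ∷ (# 4 , # 2) ∷ []
safe false false = (# 0 , # 2) ∷ (# 0 , # 4) ∷ (# 1 , # 3) ∷ (# 2 , # 0)
                 ∷ (# 2 , # 4) ∷ (# 3 , # 1) ∷ (# 4 , # 0) ∷ (# 4 , # 2) ∷ []

safe-nonempty : ∀ r r′ → ∃ (_∈ safe r r′)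
safe-nonempty true  true  = _ , here refl
safe-nonempty true  false = _ , here refl
safe-nonempty false true  = _ , here refl
safe-nonempty false false = _ , here refl

FitsRung : Bool → Column → Set
FitsRung r (a , b) = Fits 1 r (distance a b)

opaque
  safe-fits : ∀ r r′ → All (FitsRung r) (safe r r′)
  safe-fits = from-yes (∀-Bool? λ r → ∀-Bool? λ r′ →
    All.all? (λ { (a , b) → fits? 1 r (distance a b) }) (safe r r′))

Extends : Bool → Bool → Column → Column → Set
Extends t u (a , b) (x , y) = Fits 1 t (distance a x) × Fits 1 u (distance b y)

opaque
  safe-extends : ∀ r r′ r″ t u → All (λ p → Any (Extends t u p) (safe r′ r″)) (safe r r′)
  safe-extends = from-yes (∀-Bool? λ r → ∀-Bool? λ r′ → ∀-Bool? λ r″ → ∀-Bool? λ t → ∀-Bool? λ u →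
    All.all? (λ { (a , b) → Any.any? (λ { (x , y) →
      fits? 1 t (distance a x) ×-dec fits? 1 u (distance b y) }) (safe r′ r″) }) (safe r r′))

module LadderColouring (n : ℕ) (L : NearFar (Ladder n)) where

  -- Positions beyond n are sent to vertex 0; only the rung label at n + 1 is
  -- read this way, as look-ahead for the last column, where it is irrelevant.
  vertex : ℕ → Fin (suc n)
  vertex k with k <? suc n
  ... | yes k<1+n = fromℕ< k<1+n
  ... | no  _     = fzero

  vertex-toℕ : ∀ v → vertex (toℕ v) ≡ v
  vertex-toℕ v with toℕ v <? suc n
  ... | yes v<1+n = fromℕ<-toℕ v v<1+n
  ... | no  v≮1+n = ⊥-elim (v≮1+n (toℕ<n v))

  top bottom : Fin 2
  top    = fzero
  bottom = fsuc fzero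

  rung : ℕ → Bool
  rung k = near L (vertex k , top) (vertex k , bottom)

  rail : Fin 2 → ℕ → Bool
  rail w k = near L (vertex k , w) (vertex (suc k) , w)

  column : ∀ k → ∃ (_∈ safe (rung k) (rung (suc k)))
  extension : ∀ k → ∃ λ q → q ∈ safe (rung (suc k)) (rung (suc (suc k)))
                          × Extends (rail top k) (rail bottom k) (proj₁ (column k)) q

  column zero    = safe-nonempty (rung 0) (rung 1)
  column (suc k) = proj₁ (extension k) , proj₁ (proj₂ (extension k))

  extension k = find (All.lookup
    (safe-extends (rung k) (rung (suc k)) (rung (suc (suc k))) (rail top k) (rail bottom k))
    (proj₂ (column k)))

  entry : Fin 2 → Column → Colour
  entry fzero    = proj₁
  entry (fsuc _) = proj₂

  colourAt : ℕ → Fin 2 → Colour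
  colourAt k w = entry w (proj₁ (column k))

  colour : Vtx (P n) × Vtx K2 → Colour
  colour (v , w) = colourAt (toℕ v) w

  rung-fits : ∀ v → FitsEdge L colour 1 (v , top) (v , bottom)
  rung-fits v =
    subst (λ z → Fits 1 (near L (z , top) (z , bottom)) (distance (colour (v , top)) (colour (v , bottom))))
      (vertex-toℕ v)
    (All.lookup (safe-fits _ _) (proj₂ (column (toℕ v))))

  rail-step : ∀ w k → Fits 1 (rail w k) (distance (colourAt k w) (colourAt (suc k) w))
  rail-step fzero        k = proj₁ (proj₂ (proj₂ (extension k)))
  rail-step (fsuc fzero) k = proj₂ (proj₂ (proj₂ (extension k)))

  rail-fits : ∀ v x w → toℕ x ≡ suc (toℕ v) → FitsEdge L colour 1 (v , w) (x , w)
  rail-fits v x w x≡1+v rewrite x≡1+v =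
    subst₂ (λ y z → Fits 1 (near L (y , w) (z , w)) (distance (colourAt (toℕ v) w) (colourAt (suc (toℕ v)) w)))
      (vertex-toℕ v) (subst (λ k → vertex k ≡ x) x≡1+v (vertex-toℕ x))
      (rail-step w (toℕ v))

  edge-fits : ∀ {p q} → GraphOn.E (Ladder n) p q → FitsEdge L colour 1 p q
  edge-fits {v , fzero}      {_ , fzero}      (inj₁ (refl , w≢y)) = ⊥-elim (w≢y refl)
  edge-fits {v , fzero}      {_ , fsuc fzero} (inj₁ (refl , _))   = rung-fits v
  edge-fits {v , fsuc fzero} {_ , fzero}    e@(inj₁ (refl , _))   = fitsEdge-sym L colour 1 e (rung-fits v)
  edge-fits {v , fsuc fzero} {_ , fsuc fzero} (inj₁ (refl , w≢y)) = ⊥-elim (w≢y refl)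
  edge-fits {v , w} {x , _} e@(inj₂ (refl , ∣v-x∣≡1)) with ∣m-n∣≡1⇒n≡1+m⊎m≡1+n (toℕ v) (toℕ x) ∣v-x∣≡1
  ... | inj₁ x≡1+v = rail-fits v x w x≡1+v
  ... | inj₂ v≡1+x = fitsEdge-sym L colour 1 e (rail-fits x v w v≡1+x)

lemma4 : (n : ℕ) → TotalThresholdColorable (Ladder n) 5 1
lemma4 n L = colour , fitsEdge⇒thresholdColoring L colour 1 edge-fits
  where open LadderColouring n L
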